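{- For quivers $Q,R$ define the quiver $R^Q$ by $\overrightarrow{V}(R^Q)=\mathbf{Set}(\overrightarrow{V}(Q),\overrightarrow{V}(R))$, $\overrightarrow{E}(R^Q)=\mathfrak{R}(\Upsilon(Q),\Upsilon(R))$, $\sigma_{R^Q}(\phi)=\check V(\phi)$, $\tau_{R^Q}(\phi)=\check E(\phi)$, and define the quiver morphism $\varepsilon^Q_R:Q\times R^Q\to R$ by $\overrightarrow{V}(\varepsilon^Q_R)(v,f)=f(v)$ and $\overrightarrow{E}(\varepsilon^Q_R)(e,\phi)=I(\phi)(e)$. Then for every quiver $K$ and every morphism $\psi:Q\times K\to R$ in $\mathfrak{Q}$ there is a unique morphism $\hat\psi:K\to R^Q$ in $\mathfrak{Q}$ such that $\varepsilon^Q_R\circ(Q\times\hat\psi)=\psi$.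
   Context: A quiver $Q$ consists of sets $\overrightarrow{V}(Q)$, $\overrightarrow{E}(Q)$ and functions $\sigma_Q,\tau_Q:\overrightarrow{E}(Q)\to\overrightarrow{V}(Q)$; morphisms are pairs of functions commuting with $\sigma,\tau$; category $\mathfrak{Q}$. The product $Q\times K$ in $\mathfrak{Q}$ has vertices $\overrightarrow{V}(Q)\times\overrightarrow{V}(K)$, edges $\overrightarrow{E}(Q)\times\overrightarrow{E}(K)$, source $\sigma_Q\times\sigma_K$, target $\tau_Q\times\tau_K$. An incidence hypergraph $G$ consists of sets $\check V(G)$, $\check E(G)$, $I(G)$ and functions $\varsigma_G:I(G)\to\check V(G)$, $\omega_G:I(G)\to\check E(G)$; a morphism is a triple $(\check V(\phi),\check E(\phi),I(\phi))$ with $\varsigma_H\circ I(\phi)=\check V(\phi)\circ\varsigma_G$ and $\omega_H\circ I(\phi)=\check E(\phi)\circ\omega_G$; category $\mathfrak{R}$ with hom-sets $\mathfrak{R}(G,H)$. $\Upsilon(Q)$ is the incidence hypergraph with $\check V=\check E=\overrightarrow{V}(Q)$, $I=\overrightarrow{E}(Q)$, $\varsigma=\sigma_Q$, $\omega=\tau_Q$. -}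

module Defs where

open import Data.Product using (_×_; _,_; proj₁; proj₂; Σ; ∃!)
open import Relation.Binary.PropositionalEquality using (_≡_)

record Quiver : Set₁ where
  field
    V : Set
    E : Set
    σ : E → V
    τ : E → V
open Quiver public

record QMor (Q K : Quiver) : Set where
  field
    Vmap : V Q → V K
    Emap : E Q → E K
    σ-comm : ∀ e → σ K (Emap e) ≡ Vmap (σ Q e)
    τ-comm : ∀ e → τ K (Emap e) ≡ Vmap (τ Q e)
open QMor public

_∘Q_ : ∀ {A B C} → QMor B C → QMor A B → QMor A C
_∘Q_ {A} {B} {C} g f = record
  { Vmap = λ v → Vmap g (Vmap f v)
  ; Emap = λ e → Emap g (Emap f e)
  ; σ-comm = λ e → trans' (σ-comm g (Emap f e)) (cong' (Vmap g) (σ-comm f e))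
  ; τ-comm = λ e → trans' (τ-comm g (Emap f e)) (cong' (Vmap g) (τ-comm f e))
  }
  where
  open import Relation.Binary.PropositionalEquality using () renaming (trans to trans'; cong to cong')

_≈Q_ : ∀ {Q K} → QMor Q K → QMor Q K → Set
f ≈Q g = (∀ v → Vmap f v ≡ Vmap g v) × (∀ e → Emap f e ≡ Emap g e)

_×Q_ : Quiver → Quiver → Quiver
Q ×Q K = record
  { V = V Q × V K
  ; E = E Q × E K
  ; σ = λ { (e , k) → σ Q e , σ K k }
  ; τ = λ { (e , k) → τ Q e , τ K k }
  }

idQ×_ : ∀ {Q K K'} → QMor K K' → QMor (Q ×Q K) (Q ×Q K')
idQ×_ {Q} ψ = record
  { Vmap = λ { (v , k) → v , Vmap ψ k }
  ; Emap = λ { (e , k) → e , Emap ψ k }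
  ; σ-comm = λ { (e , k) → cong' (σ Q e ,_) (σ-comm ψ k) }
  ; τ-comm = λ { (e , k) → cong' (τ Q e ,_) (τ-comm ψ k) }
  }
  where
  open import Relation.Binary.PropositionalEquality using () renaming (cong to cong')

record IHyp : Set₁ where
  field
    Vc : Set
    Ec : Set
    I  : Set
    ς  : I → Vc
    ω  : I → Ec
open IHyp public

record RMor (G H : IHyp) : Set where
  field
    VcMap : Vc G → Vc H
    EcMap : Ec G → Ec H
    IMap  : I G → I H
    ς-comm : ∀ i → ς H (IMap i) ≡ VcMap (ς G i)
    ω-comm : ∀ i → ω H (IMap i) ≡ EcMap (ω G i)
open RMor public

_≈R_ : ∀ {G H} → RMor G H → RMor G H → Set
f ≈R g = (∀ v → VcMap f v ≡ VcMap g v) × (∀ e → EcMap f e ≡ EcMap g e)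
       × (∀ i → IMap f i ≡ IMap g i)

Υ : Quiver → IHyp
Υ Q = record { Vc = V Q ; Ec = V Q ; I = E Q ; ς = σ Q ; ω = τ Q }

Exp : Quiver → Quiver → Quiver
Exp Q R = record
  { V = V Q → V R
  ; E = RMor (Υ Q) (Υ R)
  ; σ = VcMap
  ; τ = EcMap
  }

ev : (Q R : Quiver) → QMor (Q ×Q Exp Q R) R
ev Q R = record
  { Vmap = λ { (v , f) → f v }
  ; Emap = λ { (e , φ) → IMap φ e }
  ; σ-comm = λ { (e , φ) → ς-comm φ e }
  ; τ-comm = λ { (e , φ) → ω-comm φ e }
  }

_≈Exp_ : ∀ {K Q R} → QMor K (Exp Q R) → QMor K (Exp Q R) → Set
_≈Exp_ {K} f g = (∀ k v → Vmap f k v ≡ Vmap g k v) × (∀ e → Emap f e ≈R Emap g e)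

module Submission where

-- A morphism ψ : Q × K → R is curried into ψ̂ : K → R^Q.  A vertex k of K
-- goes to the vertex map v ↦ ψ(v, k); an edge a : k₀ → k₁ of K goes to the
-- incidence-hypergraph morphism Υ(Q) → Υ(R) acting by v ↦ ψ(v, k₀) on
-- vertices, v ↦ ψ(v, k₁) on edges (= vertices of Q) and e ↦ ψ(e, a) on
-- incidences; the commutation squares of this morphism are exactly those of
-- ψ at the edges (e, a).  With this choice the source and target of ψ̂(a) in
-- R^Q are ψ̂(k₀) and ψ̂(k₁) on the nose.
--
-- Existence: ε ∘ (Q × ψ̂) agrees with ψ definitionally.
-- Uniqueness: if ε ∘ (Q × χ) ≈ ψ, then evaluating at (v, k) pins down the
-- vertex part of χ, evaluating at (e, a) pins down the incidence part of
-- χ(a), and the commutation squares of χ (σ(χ a) = χ(σ a), τ(χ a) = χ(τ a))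
-- transport the vertex part to the two remaining components of χ(a).

open import Defs
open import Data.Product using (Σ; _×_; _,_)
open import Relation.Binary.PropositionalEquality using (_≡_; refl; trans; cong-app)

module _ {Q R K : Quiver} where

  curryEdge : QMor (Q ×Q K) R → E K → RMor (Υ Q) (Υ R)
  curryEdge ψ a = record
    { VcMap  = λ v → Vmap ψ (v , σ K a)
    ; EcMap  = λ v → Vmap ψ (v , τ K a)
    ; IMap   = λ e → Emap ψ (e , a)
    ; ς-comm = λ e → σ-comm ψ (e , a)
    ; ω-comm = λ e → τ-comm ψ (e , a)
    }

  curryQ : QMor (Q ×Q K) R → QMor K (Exp Q R)
  curryQ ψ = record
    { Vmap   = λ k v → Vmap ψ (v , k)
    ; Emap   = curryEdge ψ
    ; σ-comm = λ _ → refl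
    ; τ-comm = λ _ → refl
    }

  curryQ-factors : (ψ : QMor (Q ×Q K) R) → (ev Q R ∘Q (idQ× curryQ ψ)) ≈Q ψ
  curryQ-factors ψ = (λ _ → refl) , (λ _ → refl)

  curryQ-unique : (ψ : QMor (Q ×Q K) R) (χ : QMor K (Exp Q R)) →
    (ev Q R ∘Q (idQ× χ)) ≈Q ψ → χ ≈Exp curryQ ψ
  curryQ-unique ψ χ (onVertices , onEdges) = onVertexMaps , onEdgeMorphisms
    where
    onVertexMaps : ∀ k v → Vmap χ k v ≡ Vmap ψ (v , k)
    onVertexMaps k v = onVertices (v , k)

    -- The source (resp. target) component of χ(a) is χ(σ a) (resp. χ(τ a)),
    -- which the vertex equations identify with ψ(-, σ a) (resp. ψ(-, τ a)).
    onEdgeMorphisms : ∀ a → Emap χ a ≈R curryEdge ψ a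
    onEdgeMorphisms a =
        (λ v → trans (cong-app (σ-comm χ a) v) (onVertexMaps (σ K a) v))
      , (λ v → trans (cong-app (τ-comm χ a) v) (onVertexMaps (τ K a) v))
      , (λ e → onEdges (e , a))

mainTheorem20 : (Q R K : Quiver) (ψ : QMor (Q ×Q K) R) →
    Σ (QMor K (Exp Q R)) (λ ψ̂ →
      ((ev Q R ∘Q (idQ× ψ̂)) ≈Q ψ) ×
      ((χ : QMor K (Exp Q R)) → (ev Q R ∘Q (idQ× χ)) ≈Q ψ → χ ≈Exp ψ̂))
mainTheorem20 Q R K ψ = curryQ ψ , curryQ-factors ψ , curryQ-unique ψ
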